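{- $1\mathrm{SP}\subsetneqq 1\oplus$.
   Context: A one-way nondeterministic finite automaton (1nfa) is $M=(Q,\Sigma,\{\rhd,\lhd\},\delta,q_0,Q_{acc},Q_{rej})$: finite state set $Q$, input alphabet $\Sigma$, endmarkers $\rhd,\lhd\notin\Sigma$, disjoint sets $Q_{acc},Q_{rej}\subseteq Q$ ($Q_{halt}=Q_{acc}\cup Q_{rej}$), transition function $\delta:(Q-Q_{halt})\times(\Sigma\cup\{\rhd,\lhd\})\to\mathcal P(Q)$. On input $x$ it reads $\rhd x\lhd$ left to right, moving its head one cell right at every step (no $\lambda$-moves), halting on entering a halting state. A path is accepting (resp. rejecting) if it enters $Q_{acc}$ (resp. $Q_{rej}$), otherwise neither. $\#M(x)$, $\#\overline{M}(x)$ are the numbers of accepting and rejecting paths on $x$. A family $\{M_n\}_{n\in\mathbb N}$ has polynomial size if $|Q_n|\le p(n)$ for a fixed polynomial $p$. A family of promise problems over a fixed alphabet $\Sigma$ is $\mathcal L=\{(L_n^{(+)},L_n^{(-)})\}_{n\in\mathbb N}$ with $L_n^{(+)},L_n^{(-)}\subseteq\Sigma^*$ disjoint. A family of partial functions is $\{(f_n,D_n)\}_n$, $D_n\subseteq\Sigma^*$. $1\#$ (resp. $1\mathrm{Gap}$) is the class of such families for which a polynomial-size family of 1nfa's satisfies $f_n(x)=\#M_n(x)$ (resp. $f_n(x)=\#M_n(x)-\#\overline{M}_n(x)$) for all $n$, $x\in D_n$. $\mathcal L\in1\mathrm{SP}$ iff some $\{(f_n,D_n)\}\in1\mathrm{Gap}$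 has $L_n^{(+)}\cup L_n^{(-)}\subseteq D_n$, $f_n=1$ on $L_n^{(+)}$ and $f_n=0$ on $L_n^{(-)}$ for all $n$; $\mathcal L\in1\oplus$ iff some $\{(f_n,D_n)\}\in1\#$ has $L_n^{(+)}\cup L_n^{(-)}\subseteq D_n$, $f_n$ odd on $L_n^{(+)}$ and even on $L_n^{(-)}$ for all $n$. -}

module Defs where

open import Data.Nat using (ℕ; zero; suc; _+_; _*_; _≤_; _%_)
open import Data.Integer using (ℤ) renaming (_-_ to _-ℤ_; +_ to ℤ+_)
open import Data.Fin using (Fin)
open import Data.List using (List; []; _∷_; map; allFin; [_]) renaming (_++_ to _++ᴸ_)
open import Data.Nat.ListAction using (sum)
open import Data.Bool using (Bool; true; false; if_then_else_)
open import Data.Product using (Σ; ∃; _×_; _,_)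
open import Data.Empty using (⊥)
open import Relation.Binary.PropositionalEquality using (_≡_)

data Sym (k : ℕ) : Set where
  sym  : Fin k → Sym k
  lend : Sym k
  rend : Sym k

-- Classification of states: accepting, rejecting, or non-halting.
-- (This makes Q_acc and Q_rej disjoint by construction.)
data Kind : Set where
  accK rejK nonK : Kind

-- A 1nfa over alphabet Fin k with state set Fin states.
-- δ q a q' = true  iff  q' ∈ δ(q,a).  δ is only consulted on non-halting q.
record NFA (k : ℕ) : Set where
  field
    states : ℕ
    δ      : Fin states → Sym k → Fin states → Bool
    q₀     : Fin states
    kind   : Fin states → Kind

open NFA public

boolℕ : Bool → ℕ
boolℕ true  = 1
boolℕ false = 0

sumFin : (m : ℕ) → (Fin m → ℕ) → ℕ
sumFin m f = sum (map f (allFin m))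

-- A path halts as soon as it enters a halting state; when the tape is
-- exhausted in a non-halting state the path is neither accepting nor rejecting.
countFrom : ∀ {k} → (M : NFA k) → Kind → Fin (states M) → List (Sym k) → ℕ
countFrom M t q w with kind M q
countFrom M accK q w | accK = 1
countFrom M rejK q w | accK = 0
countFrom M nonK q w | accK = 0
countFrom M accK q w | rejK = 0
countFrom M rejK q w | rejK = 1
countFrom M nonK q w | rejK = 0
countFrom M t q [] | nonK = 0
countFrom M t q (a ∷ w) | nonK =
  sumFin (states M) (λ q' → boolℕ (δ M q a q') * countFrom M t q' w)

tape : ∀ {k} → List (Fin k) → List (Sym k)
tape x = lend ∷ (map sym x ++ᴸ [ rend ])

#acc : ∀ {k} → NFA k → List (Fin k) → ℕ
#acc M x = countFrom M accK (q₀ M) (tape x)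

#rej : ∀ {k} → NFA k → List (Fin k) → ℕ
#rej M x = countFrom M rejK (q₀ M) (tape x)

gap : ∀ {k} → NFA k → List (Fin k) → ℤ
gap M x = ℤ+ (#acc M x) -ℤ ℤ+ (#rej M x)

-- Polynomials with natural-number coefficients (list of coefficients,
-- lowest degree first), evaluated by Horner's rule.
evalPoly : List ℕ → ℕ → ℕ
evalPoly []       n = 0
evalPoly (c ∷ cs) n = c + n * evalPoly cs n

PolySize : ∀ {k} → (ℕ → NFA k) → Set
PolySize M = Σ (List ℕ) λ p → ∀ n → states (M n) ≤ evalPoly p n

record PromiseFamily (k : ℕ) : Set₁ where
  field
    Lplus  : ℕ → List (Fin k) → Set
    Lminus : ℕ → List (Fin k) → Set
    disjoint : ∀ n x → Lplus n x → Lminus n x → ⊥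

open PromiseFamily public

-- 1# and 1Gap, on families of partial functions (f_n, D_n).
In1Sharp : ∀ {k} → (ℕ → List (Fin k) → ℕ) → (ℕ → List (Fin k) → Set) → Set
In1Sharp {k} f D = Σ (ℕ → NFA k) λ M → PolySize M ×
  (∀ n x → D n x → f n x ≡ #acc (M n) x)

In1Gap : ∀ {k} → (ℕ → List (Fin k) → ℤ) → (ℕ → List (Fin k) → Set) → Set
In1Gap {k} f D = Σ (ℕ → NFA k) λ M → PolySize M ×
  (∀ n x → D n x → f n x ≡ gap (M n) x)

In1SP : ∀ {k} → PromiseFamily k → Set₁
In1SP {k} L = Σ (ℕ → List (Fin k) → ℤ) λ f → Σ (ℕ → List (Fin k) → Set) λ D →
  In1Gap f D ×
  (∀ n x → Lplus L n x → D n x) × (∀ n x → Lminus L n x → D n x) ×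
  (∀ n x → Lplus L n x → f n x ≡ ℤ+ 1) × (∀ n x → Lminus L n x → f n x ≡ ℤ+ 0)

In1Parity : ∀ {k} → PromiseFamily k → Set₁
In1Parity {k} L = Σ (ℕ → List (Fin k) → ℕ) λ f → Σ (ℕ → List (Fin k) → Set) λ D →
  In1Sharp f D ×
  (∀ n x → Lplus L n x → D n x) × (∀ n x → Lminus L n x → D n x) ×
  (∀ n x → Lplus L n x → f n x % 2 ≡ 1) × (∀ n x → Lminus L n x → f n x % 2 ≡ 0)

-- If gap M = #acc − #rej is 0 or 1, declaring all halting states accepting yields #acc + #rej,
-- which has the parity of the gap; hence 1SP ⊆ 1⊕.
--
-- For the separation let IPₙ(x) = u·v mod 2 for x = uv with |u| = |v| = n.  A 1nfa with n + 3
-- states guesses i with uᵢ = 1 and checks vᵢ = 1, so its number of accepting paths is u·v.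
-- Conversely, the gap of any 1nfa M on uv decomposes through the state reached after u, so
-- if gap(uv) = IPₙ(uv) then the 2ⁿ × 2ⁿ Hadamard matrix (−1)^(u·v) = 1 − 2·gap(uv) factors
-- through ℤ^(|Q| + 2).  Its rows are linearly independent, so |Q| + 2 ≥ 2ⁿ, and no
-- polynomial-size family can have gap IPₙ.

module Submission where

open import Defs renaming (sym to symbol)
open import Data.Nat using (ℕ)
open import Data.Fin using (Fin; zero; suc; toℕ; fromℕ; inject₁)
import Data.Fin.Properties as FinP
open import Data.List using (List; []; _∷_; map; tabulate; length; take; drop; [_]; _++_)
import Data.List.Properties as ListP
open import Data.Bool using (Bool; true; false; _∧_)
open import Data.Product using (Σ; _×_; _,_)
open import Data.Unit using (⊤; tt)
open import Function using (_∘_; id)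
open import Relation.Nullary using (¬_; does)
open import Algebra.Bundles using (Semiring)
import Algebra.Properties.Semiring.Sum as SemiringSum

module SumProperties {c ℓ} (R : Semiring c ℓ) where

  open Semiring R
  open SemiringSum R public
  open import Relation.Binary.Reasoning.Setoid setoid
  open import Data.Nat.Base as ℕ using (zero; suc)
  open import Data.Fin using (_↑ˡ_; _↑ʳ_; combine)

  ∑-mul-∑ : ∀ {m p} (a : Fin m → Carrier) (b : Fin m → Fin p → Carrier) (c : Fin p → Carrier) →
    ∑[ i < m ] (a i * ∑[ j < p ] (b i j * c j)) ≈ ∑[ j < p ] (∑[ i < m ] (a i * b i j) * c j)
  ∑-mul-∑ {m} {p} a b c = begin
    ∑[ i < m ] (a i * ∑[ j < p ] (b i j * c j))  ≈⟨ sum-cong-≋ (λ i → *-distribˡ-sum (a i) λ j → b i j * c j) ⟩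
    ∑[ i < m ] ∑[ j < p ] (a i * (b i j * c j))  ≈⟨ ∑-comm (λ i j → a i * (b i j * c j)) ⟩
    ∑[ j < p ] ∑[ i < m ] (a i * (b i j * c j))  ≈⟨ sum-cong-≋ (λ j → sum-cong-≋ λ i → *-assoc (a i) (b i j) (c j)) ⟨
    ∑[ j < p ] ∑[ i < m ] (a i * b i j * c j)    ≈⟨ sum-cong-≋ (λ j → *-distribʳ-sum (c j) λ i → a i * b i j) ⟨
    ∑[ j < p ] (∑[ i < m ] (a i * b i j) * c j)  ∎

  ∑-↑ : ∀ {m k} (f : Fin (m ℕ.+ k) → Carrier) → ∑[ i < m ℕ.+ k ] f i ≈ ∑[ i < m ] f (i ↑ˡ k) + ∑[ j < k ] f (m ↑ʳ j)
  ∑-↑ {zero}  f = sym (+-identityˡ _)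
  ∑-↑ {suc m} {k} f = trans (+-congˡ (∑-↑ {m} {k} (f ∘ suc))) (sym (+-assoc _ _ _))

  ∑-combine : ∀ {m k} (f : Fin (m ℕ.* k) → Carrier) → ∑[ i < m ℕ.* k ] f i ≈ ∑[ a < m ] ∑[ j < k ] f (combine a j)
  ∑-combine {zero}      f = refl
  ∑-combine {suc m} {k} f = trans (∑-↑ {k} {m ℕ.* k} f) (+-congˡ (∑-combine {m} {k} (f ∘ (k ↑ʳ_))))

open import Relation.Binary.PropositionalEquality hiding ([_])
import Data.Nat.Properties as ℕP
import Data.Integer.Properties as ℤP

module ℕΣ = SumProperties ℕP.+-*-semiring
module ℤΣ = SumProperties ℤP.+-*-semiring

module PathCounting where

  open import Data.Nat using (ℕ; zero; suc; _+_; _*_)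
  open import Data.Nat.ListAction using (sum)
  open import Data.Nat.Tactic.RingSolver using (solve-∀)

  ∑ℕ-syntax : ∀ n → (Fin n → ℕ) → ℕ
  ∑ℕ-syntax _ = ℕΣ.sum

  syntax ∑ℕ-syntax n (λ i → x) = ∑ℕ[ i < n ] x

  sum-tabulate : ∀ {m} (f : Fin m → ℕ) → sum (tabulate f) ≡ ∑ℕ[ i < m ] f i
  sum-tabulate {zero}  f = refl
  sum-tabulate {suc m} f = cong (f zero +_) (sum-tabulate (f ∘ suc))

  sumFin≡∑ : ∀ m (f : Fin m → ℕ) → sumFin m f ≡ ∑ℕ[ i < m ] f i
  sumFin≡∑ m f = trans (cong sum (ListP.map-tabulate id f)) (sum-tabulate f)

  ∑-indicator : ∀ {m} (i : Fin m) (f : Fin m → ℕ) →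
    ∑ℕ[ j < m ] (boolℕ (does (i FinP.≟ j)) * f j) ≡ f i
  ∑-indicator {suc m} zero f = begin
    f zero + 0 + ∑ℕ[ _ < m ] 0 ≡⟨ cong₂ _+_ (ℕP.+-identityʳ (f zero)) (ℕΣ.sum-replicate-zero m) ⟩
    f zero + 0                ≡⟨ ℕP.+-identityʳ (f zero) ⟩
    f zero                    ∎
    where open ≡-Reasoning
  ∑-indicator {suc m} (suc i) f = ∑-indicator i (f ∘ suc)

  boolℕ-∧ : ∀ b c → boolℕ (b ∧ c) ≡ boolℕ b * boolℕ c
  boolℕ-∧ false c = refl
  boolℕ-∧ true  c = sym (ℕP.+-identityʳ (boolℕ c))

  hits : Kind → Kind → ℕ
  hits t    nonK = 0
  hits accK accK = 1
  hits rejK accK = 0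
  hits nonK accK = 0
  hits accK rejK = 0
  hits rejK rejK = 1
  hits nonK rejK = 0

  live : Kind → ℕ
  live nonK = 1
  live accK = 0
  live rejK = 0

  module _ {k} (M : NFA k) where

    countFrom-[] : ∀ t q → countFrom M t q [] ≡ hits t (kind M q)
    countFrom-[] t q with kind M q
    countFrom-[] accK q | accK = refl
    countFrom-[] rejK q | accK = refl
    countFrom-[] nonK q | accK = refl
    countFrom-[] accK q | rejK = refl
    countFrom-[] rejK q | rejK = refl
    countFrom-[] nonK q | rejK = refl
    countFrom-[] t    q | nonK = refl

    countFrom-∷ : ∀ t q a w → countFrom M t q (a ∷ w) ≡
      hits t (kind M q) + live (kind M q) * ∑ℕ[ q′ < states M ] (boolℕ (δ M q a q′) * countFrom M t q′ w)
    countFrom-∷ t q a w with kind M q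
    countFrom-∷ accK q a w | accK = refl
    countFrom-∷ rejK q a w | accK = refl
    countFrom-∷ nonK q a w | accK = refl
    countFrom-∷ accK q a w | rejK = refl
    countFrom-∷ rejK q a w | rejK = refl
    countFrom-∷ nonK q a w | rejK = refl
    countFrom-∷ t    q a w | nonK = trans (sumFin≡∑ (states M) _) (sym (ℕP.+-identityʳ _))

    countFrom-live : ∀ t q a w → kind M q ≡ nonK → countFrom M t q (a ∷ w) ≡
      ∑ℕ[ q′ < states M ] (boolℕ (δ M q a q′) * countFrom M t q′ w)
    countFrom-live t q a w q-live = trans (countFrom-∷ t q a w)
      (trans (cong (λ h → hits t h + live h * ∑′) q-live) (ℕP.+-identityʳ ∑′))
      where
      ∑′ = ∑ℕ[ q′ < states M ] (boolℕ (δ M q a q′) * countFrom M t q′ w)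

    private
      S = states M

    reach : Fin S → List (Sym k) → Fin S → ℕ
    reach q []      q′ = live (kind M q) * boolℕ (does (q FinP.≟ q′))
    reach q (a ∷ w) q′ = live (kind M q) * ∑ℕ[ q″ < S ] (boolℕ (δ M q a q″) * reach q″ w q′)

    countFrom-kind : ∀ t q w → countFrom M t q w ≡ hits t (kind M q) + live (kind M q) * countFrom M t q w
    countFrom-kind t q w with kind M q
    countFrom-kind accK q w | accK = refl
    countFrom-kind rejK q w | accK = refl
    countFrom-kind nonK q w | accK = refl
    countFrom-kind accK q w | rejK = refl
    countFrom-kind rejK q w | rejK = refl
    countFrom-kind nonK q w | rejK = refl
    countFrom-kind t    q w | nonK = sym (ℕP.+-identityʳ _)

    countFrom-++ : ∀ t q w₁ w₂ → countFrom M t q (w₁ ++ w₂) ≡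
      countFrom M t q w₁ + ∑ℕ[ q′ < S ] (reach q w₁ q′ * countFrom M t q′ w₂)
    countFrom-++ t q [] w₂ = begin
      countFrom M t q w₂                                          ≡⟨ countFrom-kind t q w₂ ⟩
      hits t h + live h * countFrom M t q w₂                       ≡⟨ cong (hits t h +_) stay ⟨
      hits t h + ∑ℕ[ q′ < S ] (reach q [] q′ * countFrom M t q′ w₂)  ≡⟨ cong (_+ ∑ℕ[ q′ < S ] (reach q [] q′ * countFrom M t q′ w₂)) (countFrom-[] t q) ⟨
      countFrom M t q [] + ∑ℕ[ q′ < S ] (reach q [] q′ * countFrom M t q′ w₂) ∎
      where
      open ≡-Reasoning
      h = kind M q
      stay : ∑ℕ[ q′ < S ] (reach q [] q′ * countFrom M t q′ w₂) ≡ live h * countFrom M t q w₂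
      stay = begin
        ∑ℕ[ q′ < S ] (live h * boolℕ (does (q FinP.≟ q′)) * countFrom M t q′ w₂)
          ≡⟨ ℕΣ.sum-cong-≗ (λ q′ → ℕP.*-assoc (live h) (boolℕ (does (q FinP.≟ q′))) _) ⟩
        ∑ℕ[ q′ < S ] (live h * (boolℕ (does (q FinP.≟ q′)) * countFrom M t q′ w₂))
          ≡⟨ ℕΣ.*-distribˡ-sum (live h) (λ q′ → boolℕ (does (q FinP.≟ q′)) * countFrom M t q′ w₂) ⟨
        live h * ∑ℕ[ q′ < S ] (boolℕ (does (q FinP.≟ q′)) * countFrom M t q′ w₂)
          ≡⟨ cong (live h *_) (∑-indicator q (λ q′ → countFrom M t q′ w₂)) ⟩
        live h * countFrom M t q w₂ ∎
    countFrom-++ t q (a ∷ w₁) w₂ = begin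
      countFrom M t q (a ∷ (w₁ ++ w₂))
        ≡⟨ countFrom-∷ t q a (w₁ ++ w₂) ⟩
      hits t h + live h * ∑ℕ[ q″ < S ] (step q″ * countFrom M t q″ (w₁ ++ w₂))
        ≡⟨ cong (λ s → hits t h + live h * s) split ⟩
      hits t h + live h * (∑₁ + ∑ℕ[ q″ < S ] (step q″ * ∑ℕ[ q′ < S ] (reach q″ w₁ q′ * later q′)))
        ≡⟨ regroup (hits t h) (live h) ∑₁ _ ⟩
      (hits t h + live h * ∑₁) + live h * ∑ℕ[ q″ < S ] (step q″ * ∑ℕ[ q′ < S ] (reach q″ w₁ q′ * later q′))
        ≡⟨ cong₂ _+_ (countFrom-∷ t q a w₁) (sym through) ⟨
      countFrom M t q (a ∷ w₁) + ∑ℕ[ q′ < S ] (reach q (a ∷ w₁) q′ * later q′) ∎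
      where
      open ≡-Reasoning
      h = kind M q
      step : Fin S → ℕ
      step q″ = boolℕ (δ M q a q″)
      later : Fin S → ℕ
      later q′ = countFrom M t q′ w₂
      ∑₁ = ∑ℕ[ q″ < S ] (step q″ * countFrom M t q″ w₁)
      split : ∑ℕ[ q″ < S ] (step q″ * countFrom M t q″ (w₁ ++ w₂)) ≡
              ∑₁ + ∑ℕ[ q″ < S ] (step q″ * ∑ℕ[ q′ < S ] (reach q″ w₁ q′ * later q′))
      split = trans
        (ℕΣ.sum-cong-≗ λ q″ → trans (cong (step q″ *_) (countFrom-++ t q″ w₁ w₂)) (ℕP.*-distribˡ-+ (step q″) _ _))
        (ℕΣ.∑-distrib-+ (λ q″ → step q″ * countFrom M t q″ w₁) _)
      through : live h * ∑ℕ[ q″ < S ] (step q″ * ∑ℕ[ q′ < S ] (reach q″ w₁ q′ * later q′)) ≡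
                ∑ℕ[ q′ < S ] (reach q (a ∷ w₁) q′ * later q′)
      through = begin
        live h * ∑ℕ[ q″ < S ] (step q″ * ∑ℕ[ q′ < S ] (reach q″ w₁ q′ * later q′))
          ≡⟨ cong (live h *_) (ℕΣ.∑-mul-∑ step (λ q″ → reach q″ w₁) later) ⟩
        live h * ∑ℕ[ q′ < S ] (∑ℕ[ q″ < S ] (step q″ * reach q″ w₁ q′) * later q′)
          ≡⟨ ℕΣ.*-distribˡ-sum (live h) (λ q′ → ∑ℕ[ q″ < S ] (step q″ * reach q″ w₁ q′) * later q′) ⟩
        ∑ℕ[ q′ < S ] (live h * (∑ℕ[ q″ < S ] (step q″ * reach q″ w₁ q′) * later q′))
          ≡⟨ ℕΣ.sum-cong-≗ (λ q′ → ℕP.*-assoc (live h) _ (later q′)) ⟨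
        ∑ℕ[ q′ < S ] (reach q (a ∷ w₁) q′ * later q′) ∎
      regroup : ∀ x l s r → x + l * (s + r) ≡ (x + l * s) + l * r
      regroup = solve-∀

module Inclusion where

  open import Data.Nat using (ℕ; _+_; _*_; _%_)
  open import Data.Nat.Tactic.RingSolver using (solve-∀)
  open import Data.Nat.DivMod using ([m+kn]%n≡m%n)
  import Data.Integer as ℤ
  import Data.Integer.Tactic.RingSolver as ℤSolver
  open PathCounting

  mergeHalting : Kind → Kind
  mergeHalting accK = accK
  mergeHalting rejK = accK
  mergeHalting nonK = nonK

  acceptOnHalt : ∀ {k} → NFA k → NFA k
  acceptOnHalt M = record M { kind = mergeHalting ∘ kind M }

  hits-mergeHalting : ∀ h → hits accK (mergeHalting h) ≡ hits accK h + hits rejK h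
  hits-mergeHalting accK = refl
  hits-mergeHalting rejK = refl
  hits-mergeHalting nonK = refl

  live-mergeHalting : ∀ h → live (mergeHalting h) ≡ live h
  live-mergeHalting accK = refl
  live-mergeHalting rejK = refl
  live-mergeHalting nonK = refl

  module _ {k} (M : NFA k) where

    countFrom-acceptOnHalt : ∀ q w →
      countFrom (acceptOnHalt M) accK q w ≡ countFrom M accK q w + countFrom M rejK q w
    countFrom-acceptOnHalt q [] = begin
      countFrom (acceptOnHalt M) accK q []        ≡⟨ countFrom-[] (acceptOnHalt M) accK q ⟩
      hits accK (mergeHalting (kind M q))         ≡⟨ hits-mergeHalting (kind M q) ⟩
      hits accK (kind M q) + hits rejK (kind M q) ≡⟨ sym (cong₂ _+_ (countFrom-[] M accK q) (countFrom-[] M rejK q)) ⟩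
      countFrom M accK q [] + countFrom M rejK q [] ∎
      where open ≡-Reasoning
    countFrom-acceptOnHalt q (a ∷ w) = begin
      countFrom (acceptOnHalt M) accK q (a ∷ w)                ≡⟨ countFrom-∷ (acceptOnHalt M) accK q a w ⟩
      hits accK (mergeHalting h) + live (mergeHalting h) * ∑′  ≡⟨ cong₂ (λ x y → x + y * ∑′) (hits-mergeHalting h) (live-mergeHalting h) ⟩
      (hits accK h + hits rejK h) + live h * ∑′                ≡⟨ cong (λ s → (hits accK h + hits rejK h) + live h * s) ∑′-split ⟩
      (hits accK h + hits rejK h) + live h * (∑A + ∑R)         ≡⟨ regroup (hits accK h) (hits rejK h) (live h) ∑A ∑R ⟩
      (hits accK h + live h * ∑A) + (hits rejK h + live h * ∑R) ≡⟨ sym (cong₂ _+_ (countFrom-∷ M accK q a w) (countFrom-∷ M rejK q a w)) ⟩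
      countFrom M accK q (a ∷ w) + countFrom M rejK q (a ∷ w)  ∎
      where
      open ≡-Reasoning
      h = kind M q
      S = states M
      step : Fin S → ℕ
      step q′ = boolℕ (δ M q a q′)
      ∑′ ∑A ∑R : ℕ
      ∑′ = ∑ℕ[ q′ < S ] (step q′ * countFrom (acceptOnHalt M) accK q′ w)
      ∑A = ∑ℕ[ q′ < S ] (step q′ * countFrom M accK q′ w)
      ∑R = ∑ℕ[ q′ < S ] (step q′ * countFrom M rejK q′ w)
      ∑′-split : ∑′ ≡ ∑A + ∑R
      ∑′-split = trans
        (ℕΣ.sum-cong-≗ λ q′ → trans (cong (step q′ *_) (countFrom-acceptOnHalt q′ w)) (ℕP.*-distribˡ-+ (step q′) _ _))
        (ℕΣ.∑-distrib-+ (λ q′ → step q′ * countFrom M accK q′ w) _)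
      regroup : ∀ x y l s r → (x + y) + l * (s + r) ≡ (x + l * s) + (y + l * r)
      regroup = solve-∀

  +m-+n≡+b⇒m≡b+n : ∀ {m n b} → ℤ.+ m ℤ.- ℤ.+ n ≡ ℤ.+ b → m ≡ b + n
  +m-+n≡+b⇒m≡b+n {m} {n} {b} m-n≡b = ℤP.+-injective (begin
    ℤ.+ m                         ≡⟨ x≡x-y+y (ℤ.+ m) (ℤ.+ n) ⟩
    (ℤ.+ m ℤ.- ℤ.+ n) ℤ.+ ℤ.+ n   ≡⟨ cong (ℤ._+ ℤ.+ n) m-n≡b ⟩
    ℤ.+ b ℤ.+ ℤ.+ n               ≡⟨ ℤP.pos-+ b n ⟨
    ℤ.+ (b + n)                   ∎)
    where
    open ≡-Reasoning
    x≡x-y+y : ∀ x y → x ≡ (x ℤ.- y) ℤ.+ y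
    x≡x-y+y = ℤSolver.solve-∀

  acceptOnHalt-parity : ∀ {k} (M : NFA k) x {b} → gap M x ≡ ℤ.+ b → #acc (acceptOnHalt M) x % 2 ≡ b % 2
  acceptOnHalt-parity M x {b} gap≡b = begin
    #acc (acceptOnHalt M) x % 2 ≡⟨ cong (_% 2) (countFrom-acceptOnHalt M (q₀ M) (tape x)) ⟩
    (#acc M x + r) % 2          ≡⟨ cong (λ a → (a + r) % 2) (+m-+n≡+b⇒m≡b+n gap≡b) ⟩
    (b + r + r) % 2             ≡⟨ cong (_% 2) (shift b r) ⟩
    (b + r * 2) % 2             ≡⟨ [m+kn]%n≡m%n b r 2 ⟩
    b % 2                       ∎
    where
    open ≡-Reasoning
    r = #rej M x
    shift : ∀ b r → b + r + r ≡ b + r * 2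
    shift = solve-∀

  1SP⊆1⊕ : ∀ {k} (L : PromiseFamily k) → In1SP L → In1Parity L
  1SP⊆1⊕ L (f , D , (M , poly , f≡gap) , D⁺ , D⁻ , f≡1 , f≡0) =
    (λ n → #acc (acceptOnHalt (M n))) , (λ _ _ → ⊤) ,
    ((acceptOnHalt ∘ M) , poly , λ _ _ _ → refl) ,
    (λ _ _ _ → tt) , (λ _ _ _ → tt) ,
    (λ n x x∈L⁺ → acceptOnHalt-parity (M n) x (trans (sym (f≡gap n x (D⁺ n x x∈L⁺))) (f≡1 n x x∈L⁺))) ,
    (λ n x x∈L⁻ → acceptOnHalt-parity (M n) x (trans (sym (f≡gap n x (D⁻ n x x∈L⁻))) (f≡0 n x x∈L⁻)))

module InnerProduct where

  open import Data.Nat using (ℕ; zero; suc; _+_; _*_; _∸_; _⊓_; _%_; _≤_; z≤n; s≤s)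
  open import Data.Nat.Tactic.RingSolver using (solve-∀)
  open PathCounting

  headBit : List (Fin 2) → ℕ
  headBit []      = 0
  headBit (b ∷ _) = toℕ b

  -- Missing coordinates of the second argument count as 0.
  dot : List (Fin 2) → List (Fin 2) → ℕ
  dot []      v = 0
  dot (a ∷ u) v = toℕ a * headBit v + dot u (drop 1 v)

  dot-[]ʳ : ∀ u → dot u [] ≡ 0
  dot-[]ʳ []      = refl
  dot-[]ʳ (a ∷ u) = trans (cong (_+ dot u []) (ℕP.*-zeroʳ (toℕ a))) (dot-[]ʳ u)

  dot-++ˡ : ∀ u w v → length v ≤ length u → dot (u ++ w) v ≡ dot u v
  dot-++ˡ []      w []      _       = dot-[]ʳ w
  dot-++ˡ (a ∷ u) w []      _       = cong (toℕ a * 0 +_) (dot-++ˡ u w [] z≤n)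
  dot-++ˡ (a ∷ u) w (b ∷ v) (s≤s l) = cong (toℕ a * toℕ b +_) (dot-++ˡ u w v l)

  isOne : Sym 2 → Bool
  isOne (symbol (suc zero)) = true
  isOne _                   = false

  checkAfter : ℕ → List (Sym 2) → ℕ
  checkAfter zero          _       = 1
  checkAfter (suc k)       []      = 0
  checkAfter (suc zero)    (a ∷ _) = boolℕ (isOne a)
  checkAfter (suc (suc k)) (_ ∷ t) = checkAfter (suc k) t

  isOne-symbol : ∀ b → boolℕ (isOne (symbol b)) ≡ toℕ b
  isOne-symbol zero       = refl
  isOne-symbol (suc zero) = refl

  checkAfter-tape : ∀ m x → checkAfter (suc m) (map symbol x ++ [ rend ]) ≡ headBit (drop m x)
  checkAfter-tape zero    []      = refl
  checkAfter-tape zero    (b ∷ x) = isOne-symbol b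
  checkAfter-tape (suc m) []      = refl
  checkAfter-tape (suc m) (b ∷ x) = checkAfter-tape m x

  isOne-weight : ∀ n a x →
    boolℕ (isOne (symbol a)) * checkAfter n (map symbol x ++ [ rend ]) ≡ toℕ a * headBit (drop n (a ∷ x))
  isOne-weight zero    zero       x = refl
  isOne-weight zero    (suc zero) x = refl
  isOne-weight (suc m) a          x = cong₂ _*_ (isOne-symbol a) (checkAfter-tape m x)

  drop-suc : ∀ {A : Set} n (xs : List A) → drop 1 (drop n xs) ≡ drop (suc n) xs
  drop-suc n xs = trans (ListP.drop-drop n 1 xs) (cong (λ k → drop k xs) (ℕP.+-comm n 1))

  -- State 0 starts and state 1 scans.  On reading a 1 the scanning state may also guess
  -- that the symbol n positions further on is a 1 and jump to state 2 + n.  State 2 + w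
  -- must read w more symbols, the last of which is a 1; so state 2 accepts.
  ipStep : ∀ n → Fin (3 + n) → Sym 2 → Fin (3 + n) → Bool
  ipStep n zero                       _ (suc zero)     = true
  ipStep n (suc zero)                 _ (suc zero)     = true
  ipStep n (suc zero)                 a (suc (suc w))  = isOne a ∧ does (fromℕ n FinP.≟ w)
  ipStep n (suc (suc (suc zero)))     a (suc (suc zero)) = isOne a
  ipStep n (suc (suc (suc (suc w))))  _ (suc (suc w′)) = does (suc (inject₁ w) FinP.≟ w′)
  ipStep n _                          _ _              = false

  ipKind : ∀ {n} → Fin (3 + n) → Kind
  ipKind (suc (suc zero)) = accK
  ipKind _                = nonK

  ipMachine : ℕ → NFA 2
  ipMachine n = record { states = 3 + n ; δ = ipStep n ; q₀ = zero ; kind = ipKind }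

  module _ (n : ℕ) where

    private
      M = ipMachine n

    countFrom-wait : ∀ w t → countFrom M accK (suc (suc w)) t ≡ checkAfter (toℕ w) t
    countFrom-wait zero                t       = refl
    countFrom-wait (suc w)             []      = refl
    countFrom-wait (suc zero)          (a ∷ t) = begin
      countFrom M accK (suc (suc (suc zero))) (a ∷ t)
        ≡⟨ countFrom-live M accK (suc (suc (suc zero))) a t refl ⟩
      boolℕ (isOne a) * 1 + ∑ℕ[ _ < n ] 0
        ≡⟨ cong₂ _+_ (ℕP.*-identityʳ (boolℕ (isOne a))) (ℕΣ.sum-replicate-zero n) ⟩
      boolℕ (isOne a) + 0
        ≡⟨ ℕP.+-identityʳ _ ⟩
      boolℕ (isOne a) ∎
      where open ≡-Reasoning
    countFrom-wait (suc (suc w))       (a ∷ t) = begin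
      countFrom M accK (suc (suc (suc (suc w)))) (a ∷ t)
        ≡⟨ countFrom-live M accK (suc (suc (suc (suc w)))) a t refl ⟩
      ∑ℕ[ w′ < suc n ] (boolℕ (does (suc (inject₁ w) FinP.≟ w′)) * countFrom M accK (suc (suc w′)) t)
        ≡⟨ ∑-indicator (suc (inject₁ w)) (λ w′ → countFrom M accK (suc (suc w′)) t) ⟩
      countFrom M accK (suc (suc (suc (inject₁ w)))) t
        ≡⟨ countFrom-wait (suc (inject₁ w)) t ⟩
      checkAfter (suc (toℕ (inject₁ w))) t
        ≡⟨ cong (λ k → checkAfter (suc k) t) (FinP.toℕ-inject₁ w) ⟩
      checkAfter (suc (toℕ w)) t ∎
      where open ≡-Reasoning

    countFrom-scan : ∀ a t → countFrom M accK (suc zero) (a ∷ t) ≡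
      countFrom M accK (suc zero) t + boolℕ (isOne a) * checkAfter n t
    countFrom-scan a t = begin
      countFrom M accK (suc zero) (a ∷ t)
        ≡⟨ countFrom-live M accK (suc zero) a t refl ⟩
      1 * scan + ∑ℕ[ w < suc n ] (boolℕ (isOne a ∧ does (fromℕ n FinP.≟ w)) * wait w)
        ≡⟨ cong₂ _+_ (ℕP.*-identityˡ scan) (ℕΣ.sum-cong-≗ λ w → trans
             (cong (_* wait w) (boolℕ-∧ (isOne a) (does (fromℕ n FinP.≟ w)))) (ℕP.*-assoc (boolℕ (isOne a)) _ (wait w))) ⟩
      scan + ∑ℕ[ w < suc n ] (boolℕ (isOne a) * (boolℕ (does (fromℕ n FinP.≟ w)) * wait w))
        ≡⟨ cong (scan +_) (sym (ℕΣ.*-distribˡ-sum (boolℕ (isOne a)) λ w → boolℕ (does (fromℕ n FinP.≟ w)) * wait w)) ⟩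
      scan + boolℕ (isOne a) * ∑ℕ[ w < suc n ] (boolℕ (does (fromℕ n FinP.≟ w)) * wait w)
        ≡⟨ cong (λ c → scan + boolℕ (isOne a) * c) (∑-indicator (fromℕ n) wait) ⟩
      scan + boolℕ (isOne a) * wait (fromℕ n)
        ≡⟨ cong (λ c → scan + boolℕ (isOne a) * c) (countFrom-wait (fromℕ n) t) ⟩
      scan + boolℕ (isOne a) * checkAfter (toℕ (fromℕ n)) t
        ≡⟨ cong (λ k → scan + boolℕ (isOne a) * checkAfter k t) (FinP.toℕ-fromℕ n) ⟩
      scan + boolℕ (isOne a) * checkAfter n t ∎
      where
      open ≡-Reasoning
      scan = countFrom M accK (suc zero) t
      wait : Fin (suc n) → ℕ
      wait w = countFrom M accK (suc (suc w)) t

    countFrom-scan-tape : ∀ x → countFrom M accK (suc zero) (map symbol x ++ [ rend ]) ≡ dot x (drop n x)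
    countFrom-scan-tape []      = countFrom-scan rend []
    countFrom-scan-tape (a ∷ x) = begin
      countFrom M accK (suc zero) (symbol a ∷ rest)
        ≡⟨ countFrom-scan (symbol a) rest ⟩
      countFrom M accK (suc zero) rest + boolℕ (isOne (symbol a)) * checkAfter n rest
        ≡⟨ cong₂ _+_ (countFrom-scan-tape x) (isOne-weight n a x) ⟩
      dot x (drop n x) + toℕ a * headBit (drop n (a ∷ x))
        ≡⟨ ℕP.+-comm (dot x (drop n x)) _ ⟩
      toℕ a * headBit (drop n (a ∷ x)) + dot x (drop n x)
        ≡⟨ cong (λ v → toℕ a * headBit (drop n (a ∷ x)) + dot x v) (drop-suc n (a ∷ x)) ⟨
      dot (a ∷ x) (drop n (a ∷ x)) ∎
      where
      open ≡-Reasoning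
      rest = map symbol x ++ [ rend ]

    #acc-ipMachine : ∀ x → #acc M x ≡ dot x (drop n x)
    #acc-ipMachine x = begin
      #acc M x                             ≡⟨ countFrom-live M accK zero lend rest refl ⟩
      1 * scan + ∑ℕ[ _ < suc n ] 0         ≡⟨ cong₂ _+_ (ℕP.*-identityˡ scan) (ℕΣ.sum-replicate-zero (suc n)) ⟩
      scan + 0                             ≡⟨ ℕP.+-identityʳ scan ⟩
      scan                                 ≡⟨ countFrom-scan-tape x ⟩
      dot x (drop n x)                     ∎
      where
      open ≡-Reasoning
      rest = map symbol x ++ [ rend ]
      scan = countFrom M accK (suc zero) rest

  dot-drop≡dot-halves : ∀ n x → length x ≡ n + n → dot x (drop n x) ≡ dot (take n x) (drop n x)
  dot-drop≡dot-halves n x len = begin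
    dot x (drop n x)                        ≡⟨ cong (λ y → dot y (drop n x)) (ListP.take++drop≡id n x) ⟨
    dot (take n x ++ drop n x) (drop n x)   ≡⟨ dot-++ˡ (take n x) (drop n x) (drop n x) (ℕP.≤-reflexive halves) ⟩
    dot (take n x) (drop n x)               ∎
    where
    open ≡-Reasoning
    halves : length (drop n x) ≡ length (take n x)
    halves = begin
      length (drop n x) ≡⟨ ListP.length-drop n x ⟩
      length x ∸ n      ≡⟨ cong (_∸ n) len ⟩
      n + n ∸ n         ≡⟨ ℕP.m+n∸m≡n n n ⟩
      n                 ≡⟨ ℕP.m≤n⇒m⊓n≡m (ℕP.m≤m+n n n) ⟨
      n ⊓ (n + n)       ≡⟨ cong (n ⊓_) len ⟨
      n ⊓ length x      ≡⟨ ListP.length-take n x ⟨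
      length (take n x) ∎

  innerProduct : PromiseFamily 2
  innerProduct = record
    { Lplus    = λ n x → length x ≡ n + n × dot (take n x) (drop n x) % 2 ≡ 1
    ; Lminus   = λ n x → length x ≡ n + n × dot (take n x) (drop n x) % 2 ≡ 0
    ; disjoint = λ { _ _ (_ , odd) (_ , even) → ℕP.1+n≢0 (trans (sym odd) even) }
    }

  innerProduct∈1⊕ : In1Parity innerProduct
  innerProduct∈1⊕ =
    (λ n → #acc (ipMachine n)) , (λ _ _ → ⊤) ,
    (ipMachine , (3 ∷ 1 ∷ [] , λ n → ℕP.+-monoʳ-≤ 3 (ℕP.≤-reflexive (linear n))) , λ _ _ _ → refl) ,
    (λ _ _ _ → tt) , (λ _ _ _ → tt) ,
    (λ n x (len , odd)  → trans (cong (_% 2) (ip-count n x len)) odd) ,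
    (λ n x (len , even) → trans (cong (_% 2) (ip-count n x len)) even)
    where
    linear : ∀ n → n ≡ n * (1 + n * 0)
    linear = solve-∀
    ip-count : ∀ n x → length x ≡ n + n → #acc (ipMachine n) x ≡ dot (take n x) (drop n x)
    ip-count n x len = trans (#acc-ipMachine n x) (dot-drop≡dot-halves n x len)

module LinearDependence where

  open import Data.Nat as ℕ using (ℕ; zero; suc; s≤s)
  open import Data.Integer using (ℤ; _+_; _*_; -_; _-_; 0ℤ; 1ℤ; _≟_)
  open import Data.Fin using (punchIn)
  open import Data.Vec.Functional using (insertAt)
  import Data.Vec.Functional.Properties as VecP
  open import Data.Sum using (inj₁; inj₂)
  open import Relation.Nullary using (yes; no)
  import Data.Integer.Tactic.RingSolver as ℤSolver
  open ℤΣ using (sum-syntax)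

  NontrivialRelation : ∀ {m t} → (Fin m → Fin t → ℤ) → Set
  NontrivialRelation {m} {t} v =
    Σ (Fin m → ℤ) λ z → (Σ (Fin m) λ i → z i ≢ 0ℤ) × (∀ q → ∑[ i < m ] (z i * v i q) ≡ 0ℤ)

  *-≢0 : ∀ {x y} → x ≢ 0ℤ → y ≢ 0ℤ → x * y ≢ 0ℤ
  *-≢0 {x} x≢0 y≢0 xy≡0 with ℤP.i*j≡0⇒i≡0∨j≡0 x xy≡0
  ... | inj₁ x≡0 = x≢0 x≡0
  ... | inj₂ y≡0 = y≢0 y≡0

  ∑-insertAt : ∀ {m} (z : Fin m → ℤ) p c (f : Fin (suc m) → ℤ) →
    ∑[ i < suc m ] (insertAt z p c i * f i) ≡ c * f p + ∑[ j < m ] (z j * f (punchIn p j))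
  ∑-insertAt z p c f = trans (ℤΣ.sum-remove {i = p} (λ i → insertAt z p c i * f i))
    (cong₂ _+_ (cong (_* f p) (VecP.insertAt-lookup z p c))
               (ℤΣ.sum-cong-≗ λ j → cong (_* f (punchIn p j)) (VecP.insertAt-punchIn z p c j)))

  -- One step of Gaussian elimination: clear the first coordinate using the pivot row p.
  eliminate : ∀ {m t} (v : Fin (suc m) → Fin (suc t) → ℤ) p → v p zero ≢ 0ℤ →
    NontrivialRelation (λ j q → v p zero * v (punchIn p j) (suc q) - v (punchIn p j) zero * v p (suc q)) →
    NontrivialRelation v
  eliminate {m} {t} v p pivot≢0 (z′ , (i , z′i≢0) , z′-rel) =
    z , (punchIn p i , nonzero) , rel
    where
    p₀ = v p zero
    w : Fin m → Fin (suc t) → ℤ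
    w j = v (punchIn p j)
    A : Fin (suc t) → ℤ
    A q = ∑[ j < m ] (z′ j * w j q)
    z : Fin (suc m) → ℤ
    z = insertAt (λ j → p₀ * z′ j) p (- A zero)
    nonzero : z (punchIn p i) ≢ 0ℤ
    nonzero rewrite VecP.insertAt-punchIn (λ j → p₀ * z′ j) p (- A zero) i = *-≢0 pivot≢0 z′i≢0
    eliminated : ∀ q → ∑[ i < suc m ] (z i * v i q) ≡ ∑[ j < m ] (z′ j * (p₀ * w j q - w j zero * v p q))
    eliminated q = begin
      ∑[ i < suc m ] (z i * v i q)
        ≡⟨ ∑-insertAt (λ j → p₀ * z′ j) p (- A zero) (λ i → v i q) ⟩
      - A zero * v p q + ∑[ j < m ] (p₀ * z′ j * w j q)
        ≡⟨ cong (- A zero * v p q +_) (trans (ℤΣ.sum-cong-≗ λ j → ℤP.*-assoc p₀ (z′ j) (w j q))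
                                             (sym (ℤΣ.*-distribˡ-sum p₀ λ j → z′ j * w j q))) ⟩
      - A zero * v p q + p₀ * A q
        ≡⟨ swap (A zero) (v p q) p₀ (A q) ⟩
      p₀ * A q + - v p q * A zero
        ≡⟨ cong₂ _+_ (ℤΣ.*-distribˡ-sum p₀ λ j → z′ j * w j q) (ℤΣ.*-distribˡ-sum (- v p q) λ j → z′ j * w j zero) ⟩
      ∑[ j < m ] (p₀ * (z′ j * w j q)) + ∑[ j < m ] (- v p q * (z′ j * w j zero))
        ≡⟨ ℤΣ.∑-distrib-+ (λ j → p₀ * (z′ j * w j q)) _ ⟨
      ∑[ j < m ] (p₀ * (z′ j * w j q) + - v p q * (z′ j * w j zero))
        ≡⟨ ℤΣ.sum-cong-≗ (λ j → expand p₀ (z′ j) (w j q) (w j zero) (v p q)) ⟩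
      ∑[ j < m ] (z′ j * (p₀ * w j q - w j zero * v p q)) ∎
      where
      open ≡-Reasoning
      swap : ∀ a b c d → - a * b + c * d ≡ c * d + - b * a
      swap = ℤSolver.solve-∀
      expand : ∀ c z x y b → c * (z * x) + - b * (z * y) ≡ z * (c * x - y * b)
      expand = ℤSolver.solve-∀
    rel : ∀ q → ∑[ i < suc m ] (z i * v i q) ≡ 0ℤ
    rel zero    = trans (eliminated zero) (trans
      (ℤΣ.sum-cong-≗ λ j → trans (cong (z′ j *_) (cancel p₀ (w j zero))) (ℤP.*-zeroʳ (z′ j)))
      (ℤΣ.sum-replicate-zero m))
      where
      cancel : ∀ a b → a * b - b * a ≡ 0ℤ
      cancel = ℤSolver.solve-∀
    rel (suc q) = trans (eliminated (suc q)) (z′-rel q)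

  linearDependence : ∀ {m t} (v : Fin m → Fin t → ℤ) → t ℕ.< m → NontrivialRelation v
  linearDependence {suc m} {zero}  v _ = (λ _ → 1ℤ) , (zero , λ ()) , λ ()
  linearDependence {suc m} {suc t} v (s≤s t<m) with FinP.all? (λ i → v i zero ≟ 0ℤ)
  ... | yes column≡0 with linearDependence (λ i q → v i (suc q)) (ℕP.m<n⇒m<1+n t<m)
  ...   | z , nonzero , rel = z , nonzero , λ
    { zero    → trans (ℤΣ.sum-cong-≗ λ i → trans (cong (z i *_) (column≡0 i)) (ℤP.*-zeroʳ (z i)))
                      (ℤΣ.sum-replicate-zero (suc m))
    ; (suc q) → rel q }
  linearDependence {suc m} {suc t} v (s≤s t<m) | no column≢0
    with FinP.¬∀⟶∃¬ _ _ (λ i → v i zero ≟ 0ℤ) column≢0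
  ... | p , pivot≢0 = eliminate v p pivot≢0 (linearDependence _ t<m)

module Hadamard where

  open import Data.Nat as ℕ using (ℕ; zero; suc; _^_; _<_; _≤_)
  open import Data.Integer as ℤ using (ℤ; _+_; _*_; -_; _-_; 0ℤ; 1ℤ)
  open import Data.Fin using (combine; remQuot)
  open import Data.Product using (proj₁; proj₂; uncurry)
  import Data.Integer.Tactic.RingSolver as ℤSolver
  open ℤΣ using (sum-syntax)
  open InnerProduct using (dot)
  open LinearDependence using (linearDependence)

  sign : ℕ → ℤ
  sign zero    = 1ℤ
  sign (suc k) = - sign k

  hadamard : List (Fin 2) → List (Fin 2) → ℤ
  hadamard u v = sign (dot u v)

  bits : ∀ n → Fin (2 ^ n) → List (Fin 2)
  bits zero    _ = []
  bits (suc n) i = uncurry (λ a j → a ∷ bits n j) (remQuot (2 ^ n) i)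

  bits-combine : ∀ n a j → bits (suc n) (combine a j) ≡ a ∷ bits n j
  bits-combine n a j = cong (uncurry λ a j → a ∷ bits n j) (FinP.remQuot-combine a j)

  length-bits : ∀ n i → length (bits n i) ≡ n
  length-bits zero    _ = refl
  length-bits (suc n) i = cong suc (length-bits n (proj₂ (remQuot (2 ^ n) i)))

  ∑-bits-suc : ∀ n (g : Fin (2 ^ suc n) → List (Fin 2) → ℤ) →
    ∑[ i < 2 ^ suc n ] g i (bits (suc n) i) ≡
    ∑[ j < 2 ^ n ] (g (combine {2} zero j) (zero ∷ bits n j) + g (combine {2} (suc zero) j) (suc zero ∷ bits n j))
  ∑-bits-suc n g = begin
    ∑[ i < 2 ^ suc n ] g i (bits (suc n) i)
      ≡⟨ ℤΣ.∑-combine {2} {2 ^ n} (λ i → g i (bits (suc n) i)) ⟩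
    ∑[ j < 2 ^ n ] h zero j + (∑[ j < 2 ^ n ] h (suc zero) j + 0ℤ)
      ≡⟨ cong (∑[ j < 2 ^ n ] h zero j +_) (ℤP.+-identityʳ _) ⟩
    ∑[ j < 2 ^ n ] h zero j + ∑[ j < 2 ^ n ] h (suc zero) j
      ≡⟨ ℤΣ.∑-distrib-+ (h zero) (h (suc zero)) ⟨
    ∑[ j < 2 ^ n ] (h zero j + h (suc zero) j)
      ≡⟨ ℤΣ.sum-cong-≗ (λ j → cong₂ _+_ (first-bit zero j) (first-bit (suc zero) j)) ⟩
    ∑[ j < 2 ^ n ] (g (combine {2} zero j) (zero ∷ bits n j) + g (combine {2} (suc zero) j) (suc zero ∷ bits n j)) ∎
    where
    open ≡-Reasoning
    h : Fin 2 → Fin (2 ^ n) → ℤ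
    h a j = g (combine {2} a j) (bits (suc n) (combine a j))
    first-bit : ∀ a j → h a j ≡ g (combine a j) (a ∷ bits n j)
    first-bit a j = cong (g (combine a j)) (bits-combine n a j)

  twice≡0⇒≡0 : ∀ x → x + x ≡ 0ℤ → x ≡ 0ℤ
  twice≡0⇒≡0 x x+x≡0 = ℤP.*-cancelˡ-≡ (ℤ.+ 2) x 0ℤ (trans (double x) x+x≡0)
    where
    double : ∀ x → ℤ.+ 2 * x ≡ x + x
    double = ℤSolver.solve-∀

  -- Splitting off the first bit, z₀ + z₁ and z₀ − z₁ are relations among the rows for n.
  hadamard-injective : ∀ n (z : Fin (2 ^ n) → ℤ) →
    (∀ v → length v ≡ n → ∑[ i < 2 ^ n ] (z i * hadamard (bits n i) v) ≡ 0ℤ) →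
    ∀ i → z i ≡ 0ℤ
  hadamard-injective zero z rows zero = trans (sym (unit (z zero))) (rows [] refl)
    where
    unit : ∀ x → x * 1ℤ + 0ℤ ≡ x
    unit = ℤSolver.solve-∀
  hadamard-injective (suc n) z rows i =
    subst (λ k → z k ≡ 0ℤ) (FinP.combine-remQuot {2} (2 ^ n) i) (entry (remQuot {2} (2 ^ n) i))
    where
    z₀ z₁ : Fin (2 ^ n) → ℤ
    z₀ j = z (combine {2} zero j)
    z₁ j = z (combine {2} (suc zero) j)
    H : Fin (2 ^ n) → List (Fin 2) → ℤ
    H j = hadamard (bits n j)
    sum-rows : ∀ v → length v ≡ n → ∑[ j < 2 ^ n ] ((z₀ j + z₁ j) * H j v) ≡ 0ℤ
    sum-rows v len = trans (ℤΣ.sum-cong-≗ λ j → ℤP.*-distribʳ-+ (H j v) (z₀ j) (z₁ j))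
      (trans (sym (∑-bits-suc n λ i u → z i * hadamard u (zero ∷ v))) (rows (zero ∷ v) (cong suc len)))
    difference-rows : ∀ v → length v ≡ n → ∑[ j < 2 ^ n ] ((z₀ j - z₁ j) * H j v) ≡ 0ℤ
    difference-rows v len = trans (ℤΣ.sum-cong-≗ λ j → regroup (z₀ j) (z₁ j) (H j v))
      (trans (sym (∑-bits-suc n λ i u → z i * hadamard u (suc zero ∷ v))) (rows (suc zero ∷ v) (cong suc len)))
      where
      regroup : ∀ x y h → (x - y) * h ≡ x * h + y * - h
      regroup = ℤSolver.solve-∀
    halves : ∀ j → z₀ j ≡ 0ℤ × z₁ j ≡ 0ℤ
    halves j =
      twice≡0⇒≡0 (z₀ j) (trans (sum+difference (z₀ j) (z₁ j)) (cong₂ _+_ sum≡0 difference≡0)) ,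
      twice≡0⇒≡0 (z₁ j) (trans (sum-difference (z₀ j) (z₁ j)) (cong₂ _-_ sum≡0 difference≡0))
      where
      sum≡0 = hadamard-injective n (λ j → z₀ j + z₁ j) sum-rows j
      difference≡0 = hadamard-injective n (λ j → z₀ j - z₁ j) difference-rows j
      sum+difference : ∀ x y → x + x ≡ (x + y) + (x - y)
      sum+difference = ℤSolver.solve-∀
      sum-difference : ∀ x y → y + y ≡ (x + y) - (x - y)
      sum-difference = ℤSolver.solve-∀
    entry : (aj : Fin 2 × Fin (2 ^ n)) → z (uncurry combine aj) ≡ 0ℤ
    entry (zero , j)     = proj₁ (halves j)
    entry (suc zero , j) = proj₂ (halves j)

  hadamard-rank : ∀ n t (C : List (Fin 2) → Fin t → ℤ) (E : Fin t → List (Fin 2) → ℤ) →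
    (∀ u v → length u ≡ n → length v ≡ n → hadamard u v ≡ ∑[ q < t ] (C u q * E q v)) →
    2 ^ n ≤ t
  hadamard-rank n t C E factor = ℕP.≮⇒≥ t≮2ⁿ
    where
    t≮2ⁿ : ¬ t < 2 ^ n
    t≮2ⁿ t<2ⁿ with linearDependence (λ i q → C (bits n i) q) t<2ⁿ
    ... | z , (i , zᵢ≢0) , relation = zᵢ≢0 (hadamard-injective n z rows i)
      where
      rows : ∀ v → length v ≡ n → ∑[ i < 2 ^ n ] (z i * hadamard (bits n i) v) ≡ 0ℤ
      rows v len = begin
        ∑[ i < 2 ^ n ] (z i * hadamard (bits n i) v)
          ≡⟨ ℤΣ.sum-cong-≗ (λ i → cong (z i *_) (factor (bits n i) v (length-bits n i) len)) ⟩
        ∑[ i < 2 ^ n ] (z i * ∑[ q < t ] (C (bits n i) q * E q v))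
          ≡⟨ ℤΣ.∑-mul-∑ z (λ i q → C (bits n i) q) (λ q → E q v) ⟩
        ∑[ q < t ] (∑[ i < 2 ^ n ] (z i * C (bits n i) q) * E q v)
          ≡⟨ ℤΣ.sum-cong-≗ (λ q → cong (_* E q v) (relation q)) ⟩
        ∑[ q < t ] (0ℤ * E q v)
          ≡⟨ ℤΣ.sum-replicate-zero t ⟩
        0ℤ ∎
        where open ≡-Reasoning

module Growth where

  open import Data.Nat using (ℕ; zero; suc; _+_; _*_; _^_; _≤_; _<_; z≤n; s≤s; NonZero)
  open import Data.Nat.ListAction using (sum)
  open import Data.Nat.Tactic.RingSolver using (solve-∀)
  open ℕP.≤-Reasoning

  evalPoly≤ : ∀ p n .{{_ : NonZero n}} → evalPoly p n ≤ sum p * n ^ length p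
  evalPoly≤ []       n = z≤n
  evalPoly≤ (c ∷ cs) n = begin
    c + n * evalPoly cs n              ≤⟨ ℕP.+-monoʳ-≤ c (ℕP.*-monoʳ-≤ n (evalPoly≤ cs n)) ⟩
    c + n * (sum cs * x)               ≡⟨ cong (c +_) (reorder n (sum cs) x) ⟩
    c + sum cs * (n * x)               ≤⟨ ℕP.+-monoˡ-≤ _ (ℕP.m≤m*n c (n * x) {{ℕP.m^n≢0 n (suc (length cs))}}) ⟩
    c * (n * x) + sum cs * (n * x)     ≡⟨ ℕP.*-distribʳ-+ (n * x) c (sum cs) ⟨
    (c + sum cs) * (n * x)             ∎
    where
    x = n ^ length cs
    reorder : ∀ n s x → n * (s * x) ≡ s * (n * x)
    reorder = solve-∀

  n<2^n : ∀ n → n < 2 ^ n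
  n<2^n zero    = s≤s z≤n
  n<2^n (suc n) = begin-strict
    suc n             ≡⟨ ℕP.+-comm 1 n ⟩
    n + 1             <⟨ ℕP.+-mono-<-≤ (n<2^n n) (ℕP.m^n>0 2 n) ⟩
    2 ^ n + 2 ^ n     ≡⟨ cong (2 ^ n +_) (ℕP.+-identityʳ (2 ^ n)) ⟨
    2 ^ suc n         ∎

  quadratic≤2^ : ∀ j → (5 + j) + (5 + j) * (5 + j) ≤ 2 ^ (5 + j)
  quadratic≤2^ zero    = ℕP.m≤m+n 30 2
  quadratic≤2^ (suc j) = begin
    (6 + j) + (6 + j) * (6 + j)                         ≤⟨ ℕP.m≤m+n _ (j * j + 9 * j + 18) ⟩
    (6 + j) + (6 + j) * (6 + j) + (j * j + 9 * j + 18)  ≡⟨ expand j ⟩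
    2 * ((5 + j) + (5 + j) * (5 + j))                   ≤⟨ ℕP.*-monoʳ-≤ 2 (quadratic≤2^ j) ⟩
    2 ^ (6 + j)                                         ∎
    where
    expand : ∀ j → (6 + j) + (6 + j) * (6 + j) + (j * j + 9 * j + 18) ≡ 2 * ((5 + j) + (5 + j) * (5 + j))
    expand = solve-∀

  -- Evaluate at n = 2ʳ with r = 5 + K + d, where K = c + sum p and d = length p:
  -- c + p(n) ≤ K·2^(rd) < 2^(K + rd) ≤ 2^(r + r·r) ≤ 2^(2ʳ).
  polynomial<exponential : ∀ p c → Σ ℕ λ n → c + evalPoly p n < 2 ^ n
  polynomial<exponential p c = n , (begin-strict
    c + evalPoly p n       ≤⟨ ℕP.+-monoʳ-≤ c (evalPoly≤ p n {{ℕP.m^n≢0 2 r}}) ⟩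
    c + sum p * x          ≤⟨ ℕP.+-monoˡ-≤ _ (ℕP.m≤m*n c x {{x≢0}}) ⟩
    c * x + sum p * x      ≡⟨ ℕP.*-distribʳ-+ x c (sum p) ⟨
    K * x                  <⟨ ℕP.*-monoˡ-< x {{x≢0}} (n<2^n K) ⟩
    2 ^ K * x              ≡⟨ cong (2 ^ K *_) (ℕP.^-*-assoc 2 r d) ⟩
    2 ^ K * 2 ^ (r * d)    ≡⟨ ℕP.^-distribˡ-+-* 2 K (r * d) ⟨
    2 ^ (K + r * d)        ≤⟨ ℕP.^-monoʳ-≤ 2 (ℕP.+-mono-≤ K≤r (ℕP.*-monoʳ-≤ r d≤r)) ⟩
    2 ^ (r + r * r)        ≤⟨ ℕP.^-monoʳ-≤ 2 (quadratic≤2^ (K + d)) ⟩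
    2 ^ n                  ∎)
    where
    K = c + sum p
    d = length p
    r = 5 + (K + d)
    n = 2 ^ r
    x = n ^ d
    x≢0 : NonZero x
    x≢0 = ℕP.m^n≢0 n d {{ℕP.m^n≢0 2 r}}
    K≤r : K ≤ r
    K≤r = ℕP.≤-trans (ℕP.m≤m+n K d) (ℕP.m≤n+m (K + d) 5)
    d≤r : d ≤ r
    d≤r = ℕP.≤-trans (ℕP.m≤n+m d K) (ℕP.m≤n+m (K + d) 5)

module LowerBound where

  open import Data.Nat as ℕ using (ℕ; zero; suc; _%_; _^_; _≤_; _<_; s≤s)
  open import Data.Product using (proj₁; proj₂)
  open import Data.Nat.DivMod using ([m+n]%n≡m%n; m%n<n)
  open import Data.Integer as ℤ using (ℤ; +_; _+_; _*_; -_; _-_; 1ℤ)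
  open import Data.Vec.Functional using () renaming (_∷_ to _◂_)
  import Data.Integer.Tactic.RingSolver as ℤSolver
  open ℤΣ using (sum-syntax)
  open PathCounting using (∑ℕ-syntax; reach; countFrom-++)
  open InnerProduct using (dot; innerProduct)
  open Hadamard using (sign; hadamard; hadamard-rank)
  open Growth using (polynomial<exponential)

  pos-∑ : ∀ {m} (f : Fin m → ℕ) → + (∑ℕ[ i < m ] f i) ≡ ∑[ i < m ] (+ f i)
  pos-∑ {zero}  f = refl
  pos-∑ {suc m} f = trans (ℤP.pos-+ (f zero) _) (cong (_+_ (+ f zero)) (pos-∑ (f ∘ suc)))

  module _ {k} (M : NFA k) where

    private
      S = states M

    gapFrom : Fin S → List (Sym k) → ℤ
    gapFrom q w = + countFrom M accK q w - + countFrom M rejK q w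

    gapFrom-++ : ∀ q w₁ w₂ →
      gapFrom q (w₁ ++ w₂) ≡ gapFrom q w₁ + ∑[ q′ < S ] (+ reach M q w₁ q′ * gapFrom q′ w₂)
    gapFrom-++ q w₁ w₂ = begin
      + countFrom M accK q (w₁ ++ w₂) - + countFrom M rejK q (w₁ ++ w₂)
        ≡⟨ cong₂ _-_ (lift accK) (lift rejK) ⟩
      (+ countFrom M accK q w₁ + ∑ accK) - (+ countFrom M rejK q w₁ + ∑ rejK)
        ≡⟨ cong (λ x → (+ countFrom M accK q w₁ + x) - (+ countFrom M rejK q w₁ + ∑ rejK)) split ⟩
      (+ countFrom M accK q w₁ + (∑gap + ∑ rejK)) - (+ countFrom M rejK q w₁ + ∑ rejK)
        ≡⟨ cancel (+ countFrom M accK q w₁) (+ countFrom M rejK q w₁) ∑gap (∑ rejK) ⟩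
      gapFrom q w₁ + ∑gap ∎
      where
      open ≡-Reasoning
      r : Fin S → ℤ
      r q′ = + reach M q w₁ q′
      ∑ : Kind → ℤ
      ∑ t = ∑[ q′ < S ] (r q′ * + countFrom M t q′ w₂)
      ∑gap = ∑[ q′ < S ] (r q′ * gapFrom q′ w₂)
      lift : ∀ t → + countFrom M t q (w₁ ++ w₂) ≡ + countFrom M t q w₁ + ∑ t
      lift t = begin
        + countFrom M t q (w₁ ++ w₂)
          ≡⟨ cong +_ (countFrom-++ M t q w₁ w₂) ⟩
        + (countFrom M t q w₁ ℕ.+ ∑ℕ[ q′ < S ] (reach M q w₁ q′ ℕ.* countFrom M t q′ w₂))
          ≡⟨ ℤP.pos-+ (countFrom M t q w₁) _ ⟩
        + countFrom M t q w₁ + + ∑ℕ[ q′ < S ] (reach M q w₁ q′ ℕ.* countFrom M t q′ w₂)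
          ≡⟨ cong (_+_ (+ countFrom M t q w₁)) (trans (pos-∑ λ q′ → reach M q w₁ q′ ℕ.* countFrom M t q′ w₂) (ℤΣ.sum-cong-≗ λ q′ → ℤP.pos-* (reach M q w₁ q′) _)) ⟩
        + countFrom M t q w₁ + ∑ t ∎
      split : ∑ accK ≡ ∑gap + ∑ rejK
      split = trans (ℤΣ.sum-cong-≗ λ q′ → distribute (r q′) (+ countFrom M accK q′ w₂) (+ countFrom M rejK q′ w₂))
                    (ℤΣ.∑-distrib-+ (λ q′ → r q′ * gapFrom q′ w₂) _)
        where
        distribute : ∀ r a b → r * a ≡ r * (a - b) + r * b
        distribute = ℤSolver.solve-∀
      cancel : ∀ a b x y → (a + (x + y)) - (b + y) ≡ (a - b) + x
      cancel = ℤSolver.solve-∀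

  take-length-++ : ∀ {A : Set} (u v : List A) → take (length u) (u ++ v) ≡ u
  take-length-++ []      v = refl
  take-length-++ (a ∷ u) v = cong (a ∷_) (take-length-++ u v)

  drop-length-++ : ∀ {A : Set} (u v : List A) → drop (length u) (u ++ v) ≡ v
  drop-length-++ []      v = refl
  drop-length-++ (a ∷ u) v = drop-length-++ u v

  length-halves : ∀ {n} (u v : List (Fin 2)) → length u ≡ n → length v ≡ n → length (u ++ v) ≡ n ℕ.+ n
  length-halves u v |u|≡n |v|≡n = trans (ListP.length-++ u) (cong₂ ℕ._+_ |u|≡n |v|≡n)

  dot-take-drop-++ : ∀ {n} u v → length u ≡ n → dot (take n (u ++ v)) (drop n (u ++ v)) ≡ dot u v
  dot-take-drop-++ u v refl = cong₂ dot (take-length-++ u v) (drop-length-++ u v)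

  tape-++ : ∀ {k} (u v : List (Fin k)) → tape (u ++ v) ≡ (lend ∷ map symbol u) ++ (map symbol v ++ [ rend ])
  tape-++ u v = cong (lend ∷_) (trans (cong (_++ [ rend ]) (ListP.map-++ symbol u v)) (ListP.++-assoc (map symbol u) _ _))

  sign-parity : ∀ k → sign k ≡ 1ℤ - + 2 * + (k % 2)
  sign-parity zero          = refl
  sign-parity (suc zero)    = refl
  sign-parity (suc (suc k)) = begin
    - - sign k                  ≡⟨ ℤP.neg-involutive (sign k) ⟩
    sign k                      ≡⟨ sign-parity k ⟩
    1ℤ - + 2 * + (k % 2)        ≡⟨ cong (λ m → 1ℤ - + 2 * + m) ([m+n]%n≡m%n k 2) ⟨
    1ℤ - + 2 * + ((k ℕ.+ 2) % 2) ≡⟨ cong (λ m → 1ℤ - + 2 * + (m % 2)) (ℕP.+-comm k 2) ⟩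
    1ℤ - + 2 * + (suc (suc k) % 2) ∎
    where open ≡-Reasoning

  module _ (M : NFA 2) where

    private
      S = states M

    prefix suffix : List (Fin 2) → List (Sym 2)
    prefix u = lend ∷ map symbol u
    suffix v = map symbol v ++ [ rend ]

    -- hadamard u v = 1 − 2·gap(uv), with gap(uv) expanded through the state reached after u.
    row : List (Fin 2) → Fin (2 ℕ.+ S) → ℤ
    row u = 1ℤ ◂ gapFrom M (q₀ M) (prefix u) ◂ λ q → + reach M (q₀ M) (prefix u) q

    column : Fin (2 ℕ.+ S) → List (Fin 2) → ℤ
    column q v = (1ℤ ◂ - + 2 ◂ λ q′ → - + 2 * gapFrom M q′ (suffix v)) q

    hadamard-factorises : ∀ u v → gap M (u ++ v) ≡ + (dot u v % 2) →
      hadamard u v ≡ ∑[ q < 2 ℕ.+ S ] (row u q * column q v)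
    hadamard-factorises u v gap≡parity = begin
      sign (dot u v)
        ≡⟨ sign-parity (dot u v) ⟩
      1ℤ - + 2 * + (dot u v % 2)
        ≡⟨ cong (λ g → 1ℤ - + 2 * g) (trans (sym gap≡parity) decomposition) ⟩
      1ℤ - + 2 * (P + ∑[ q < S ] (R q * G q))
        ≡⟨ regroup P (∑[ q < S ] (R q * G q)) ⟩
      1ℤ * 1ℤ + (P * - + 2 + - + 2 * ∑[ q < S ] (R q * G q))
        ≡⟨ cong (λ s → 1ℤ * 1ℤ + (P * - + 2 + s)) (trans (ℤΣ.*-distribˡ-sum (- + 2) λ q → R q * G q)
             (ℤΣ.sum-cong-≗ λ q → swap (- + 2) (R q) (G q))) ⟩
      1ℤ * 1ℤ + (P * - + 2 + ∑[ q < S ] (R q * (- + 2 * G q))) ∎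
      where
      open ≡-Reasoning
      P = gapFrom M (q₀ M) (prefix u)
      R : Fin S → ℤ
      R q = + reach M (q₀ M) (prefix u) q
      G : Fin S → ℤ
      G q = gapFrom M q (suffix v)
      decomposition : gap M (u ++ v) ≡ P + ∑[ q < S ] (R q * G q)
      decomposition = trans (cong (gapFrom M (q₀ M)) (tape-++ u v)) (gapFrom-++ M (q₀ M) (prefix u) (suffix v))
      regroup : ∀ p s → 1ℤ - + 2 * (p + s) ≡ 1ℤ * 1ℤ + (p * - + 2 + - + 2 * s)
      regroup = ℤSolver.solve-∀
      swap : ∀ c r g → c * (r * g) ≡ r * (c * g)
      swap = ℤSolver.solve-∀

  innerProduct∉1SP : ¬ In1SP innerProduct
  innerProduct∉1SP (f , D , (M , (p , size) , f≡gap) , D⁺ , D⁻ , f≡1 , f≡0) =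
    ℕP.<-irrefl refl (begin-strict
      2 ^ n                   ≤⟨ hadamard-rank n _ (row (M n)) (column (M n)) factorisation ⟩
      2 ℕ.+ states (M n)      ≤⟨ ℕP.+-monoʳ-≤ 2 (size n) ⟩
      2 ℕ.+ evalPoly p n      <⟨ proj₂ (polynomial<exponential p 2) ⟩
      2 ^ n                   ∎)
    where
    open ℕP.≤-Reasoning
    n = proj₁ (polynomial<exponential p 2)
    in-promise : ∀ u v → length u ≡ n → length v ≡ n → ∀ {b} → dot u v % 2 ≡ b →
      length (u ++ v) ≡ n ℕ.+ n × dot (take n (u ++ v)) (drop n (u ++ v)) % 2 ≡ b
    in-promise u v |u|≡n |v|≡n parity =
      length-halves u v |u|≡n |v|≡n , trans (cong (_% 2) (dot-take-drop-++ u v |u|≡n)) parity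
    gap≡parity : ∀ u v → length u ≡ n → length v ≡ n → gap (M n) (u ++ v) ≡ + (dot u v % 2)
    gap≡parity u v |u|≡n |v|≡n with dot u v % 2 in parity | m%n<n (dot u v) 2
    ... | zero        | _ = let x∈L⁻ = in-promise u v |u|≡n |v|≡n parity in
      trans (sym (f≡gap n (u ++ v) (D⁻ n (u ++ v) x∈L⁻))) (f≡0 n (u ++ v) x∈L⁻)
    ... | suc zero    | _ = let x∈L⁺ = in-promise u v |u|≡n |v|≡n parity in
      trans (sym (f≡gap n (u ++ v) (D⁺ n (u ++ v) x∈L⁺))) (f≡1 n (u ++ v) x∈L⁺)
    ... | suc (suc _) | s≤s (s≤s ())
    factorisation : ∀ u v → length u ≡ n → length v ≡ n → hadamard u v ≡ ∑[ q < 2 ℕ.+ states (M n) ] (row (M n) u q * column (M n) q v)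
    factorisation u v |u|≡n |v|≡n = hadamard-factorises (M n) u v (gap≡parity u v |u|≡n |v|≡n)

proposition4p12 : ((k : ℕ) → (L : PromiseFamily k) → In1SP L → In1Parity L)
    × Σ ℕ (λ k → Σ (PromiseFamily k) (λ L → In1Parity L × ¬ In1SP L))
proposition4p12 =
  (λ _ → Inclusion.1SP⊆1⊕) ,
  (2 , InnerProduct.innerProduct , InnerProduct.innerProduct∈1⊕ , LowerBound.innerProduct∉1SP)
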